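{- Let $(G,\pi_0)$ be a colored graph, $\nu$ a sequence of vertices of $G$, and $\pi=\bar R(G,\pi_0,\nu)$. Then: (1) $\pi\preceq\pi_0$; (2) every vertex of $\nu$ lies in a singleton cell of $\pi$; (3) for every permutation $\sigma$ of the vertex set, $\bar R(G^\sigma,\pi_0^\sigma,\nu^\sigma)=\bar R(G,\pi_0,\nu)^\sigma$.
   Context: $G=(V,E)$ is a finite undirected graph with $V=\{1,\dots,n\}$. A coloring is a surjection $\pi:V\to\{1,\dots,m\}$, identified with the ordered sequence of its cells $\pi^{ -1}(1),\dots,\pi^{ -1}(m)$; $(G,\pi)$ is called a colored graph. $\pi'\preceq\pi$ means that $\pi(u)<\pi(v)$ implies $\pi'(u)<\pi'(v)$ for all $u,v$. A coloring is discrete if all cells are singletons. A permutation $\sigma$ acts by $G^\sigma=(V,\{(u^\sigma,v^\sigma):(u,v)\in E\})$ and $\pi^\sigma(v^\sigma)=\pi(v)$ (cells mapped, order preserved), and elementwise on vertex sequences and lists of cells. The procedure $\mathtt{make\_equitable}(G,\pi,\alpha)$, with $\alpha$ a list of cells of $\pi$, works as follows. Set $\pi':=\pi$. While $\pi'$ is not discrete and $\alpha\ne\emptyset$: 1. Let $W$ be the first cell of $\pi'$ lying in $\alpha$. Remove it from $\alpha$. 2. For each non-singleton cell $X$ of $\pi'$: - partition $X$ into the classes $X_1,\dots,X_k$ of vertices with equal numbers of neighbours in $W$, ordered by increasing number; - let $j$ be the smallest index with $|X_j|$ maximal; - replace $X$ in place by $X_1,\dots,X_{j-1},X_{j+1},\dots,X_k,X_j$;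 - add each $X_i$ ($i\ne j$) to $\alpha$, and if $X\in\alpha$, replace it there by $X_j$. Return $\pi'$. The refinement function is defined recursively: - $\bar R(G,\pi_0,[\,])=\mathtt{make\_equitable}(G,\pi_0,\text{list of all cells of }\pi_0)$; - $\bar R(G,\pi_0,[\nu',v])$: let $\pi'=\bar R(G,\pi_0,\nu')$, let $\pi''$ be $\pi'$ with the cell $W$ containing $v$ replaced in place by $\{v\},W\setminus\{v\}$ (in this order), and return $\mathtt{make\_equitable}(G,\pi'',[\{v\}])$. -}

module Defs where

open import Data.Bool using (Bool; true; false; _∧_; if_then_else_)
import Data.Bool as B
open import Data.Nat using (ℕ; zero; suc; _+_; _<_; _≡ᵇ_; _<ᵇ_)
open import Data.Fin using (Fin)
open import Data.Fin.Subset using (Subset; _∈_; _∩_; ∣_∣; ⁅_⁆; _-_; Nonempty)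
open import Data.Fin.Subset.Properties using (_∈?_)
open import Data.Fin.Permutation using (Permutation′; _⟨$⟩ʳ_; _⟨$⟩ˡ_)
open import Data.List using (List; []; _∷_; _++_; length; map; filter; foldl; upTo)
open import Data.List.Relation.Unary.All using (All)
import Data.List.Membership.Propositional as LM
open import Data.Maybe using (Maybe; just; nothing)
open import Data.Product using (_×_; _,_; proj₁; proj₂)
open import Data.Vec using (Vec; tabulate; lookup)
open import Data.Vec.Properties using (≡-dec)
open import Relation.Binary.PropositionalEquality using (_≡_)
open import Relation.Binary.Definitions using (DecidableEquality)
open import Relation.Nullary using (Dec; yes; no; ¬_; does)

record Graph (n : ℕ) : Set where
  field
    adj    : Fin n → Fin n → Bool
    sym    : ∀ u v → adj u v ≡ adj v u
    irrefl : ∀ v → adj v v ≡ false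
open Graph public

Cell : ℕ → Set
Cell = Subset

Coloring : ℕ → Set
Coloring n = List (Cell n)

_≟c_ : ∀ {n} → DecidableEquality (Cell n)
_≟c_ = ≡-dec B._≟_

-- π is a coloring (surjection onto {1..m}, given by its ordered cells):
-- every cell is nonempty and every vertex lies in exactly one cell.
IsColoring : ∀ {n} → Coloring n → Set
IsColoring {n} π =
  All Nonempty π × (∀ (v : Fin n) → length (filter (v ∈?_) π) ≡ 1)

-- the color π(v) of v: (0-based) position of the cell containing v
colorOf : ∀ {n} → Coloring n → Fin n → ℕ
colorOf []      v = 0
colorOf (X ∷ π) v with v ∈? X
... | yes _ = 0
... | no  _ = suc (colorOf π v)

_⪯_ : ∀ {n} → Coloring n → Coloring n → Set
_⪯_ {n} π' π = ∀ (u v : Fin n) → colorOf π u < colorOf π v → colorOf π' u < colorOf π' v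

isSingletonᵇ : ∀ {n} → Cell n → Bool
isSingletonᵇ X = ∣ X ∣ ≡ᵇ 1

discreteᵇ : ∀ {n} → Coloring n → Bool
discreteᵇ []      = true
discreteᵇ (X ∷ π) = isSingletonᵇ X ∧ discreteᵇ π

memᵇ : ∀ {n} → Cell n → List (Cell n) → Bool
memᵇ X []       = false
memᵇ X (Y ∷ ys) = if does (X ≟c Y) then true else memᵇ X ys

removeC : ∀ {n} → Cell n → List (Cell n) → List (Cell n)
removeC X []       = []
removeC X (Y ∷ ys) = if does (X ≟c Y) then removeC X ys else Y ∷ removeC X ys

replaceC : ∀ {n} → Cell n → Cell n → List (Cell n) → List (Cell n)
replaceC X Z []       = []
replaceC X Z (Y ∷ ys) = (if does (X ≟c Y) then Z else Y) ∷ replaceC X Z ys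

firstIn : ∀ {n} → Coloring n → List (Cell n) → Maybe (Cell n)
firstIn []      α = nothing
firstIn (X ∷ π) α = if memᵇ X α then just X else firstIn π α

degIn : ∀ {n} → Graph n → Cell n → Fin n → ℕ
degIn G W v = ∣ W ∩ tabulate (adj G v) ∣

classes : ∀ {n} → Graph n → Cell n → Cell n → List (Cell n)
classes {n} G W X =
  filter (λ C → (0 <ᵇ ∣ C ∣) B.≟ true)
    (map (λ c → tabulate (λ v → lookup X v ∧ (degIn G W v ≡ᵇ c))) (upTo (suc n)))

-- smallest index j with |X_j| maximal (0-based), via a scan
argmaxFrom : ∀ {n} → ℕ → ℕ → ℕ → List (Cell n) → ℕ
argmaxFrom i best bsz []       = best
argmaxFrom i best bsz (C ∷ cs) =
  if bsz <ᵇ ∣ C ∣ then argmaxFrom (suc i) i ∣ C ∣ cs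
                  else argmaxFrom (suc i) best bsz cs

argmax : ∀ {n} → List (Cell n) → ℕ
argmax []       = 0
argmax (C ∷ cs) = argmaxFrom 1 0 ∣ C ∣ cs

pick : ∀ {n} → ℕ → List (Cell n) → List (Cell n) × Maybe (Cell n)
pick j       []       = [] , nothing
pick zero    (C ∷ cs) = cs , just C
pick (suc j) (C ∷ cs) = let r = pick j cs in (C ∷ proj₁ r) , proj₂ r

refineCell : ∀ {n} → Graph n → Cell n → Cell n → List (Cell n)
           → List (Cell n) × List (Cell n)
refineCell G W X α with isSingletonᵇ X | pick (argmax (classes G W X)) (classes G W X)
... | true  | _            = (X ∷ []) , α
... | false | others , just Xj =
  (others ++ (Xj ∷ [])) , (replaceC X Xj α ++ others)
... | false | others , nothing = (X ∷ []) , α   -- unreachable (X nonempty)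

refineAll : ∀ {n} → Graph n → Cell n → Coloring n → List (Cell n)
          → Coloring n × List (Cell n)
refineAll G W []      α = [] , α
refineAll G W (X ∷ π) α =
  let r₁ = refineCell G W X α
      r₂ = refineAll G W π (proj₂ r₁)
  in (proj₁ r₁ ++ proj₁ r₂) , proj₂ r₂

meLoop : ∀ {n} → ℕ → Graph n → Coloring n → List (Cell n) → Coloring n
meLoop zero    G π α = π
meLoop (suc k) G π α with discreteᵇ π | firstIn π α
... | true  | _      = π
... | false | nothing = π
... | false | just W =
  let r = refineAll G W π (removeC W α) in meLoop k G (proj₁ r) (proj₂ r)

-- fuel |α| + n always suffices for colorings
makeEquitable : ∀ {n} → Graph n → Coloring n → List (Cell n) → Coloring n
makeEquitable {n} G π α = meLoop (length α + n) G π α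

individualize : ∀ {n} → Fin n → Coloring n → Coloring n
individualize v []      = []
individualize v (W ∷ π) with v ∈? W
... | no  _ = W ∷ individualize v π
... | yes _ = if isSingletonᵇ W then W ∷ π else ⁅ v ⁆ ∷ (W - v) ∷ π

Rbar : ∀ {n} → Graph n → Coloring n → List (Fin n) → Coloring n
Rbar G π₀ ν =
  foldl (λ π' v → makeEquitable G (individualize v π') (⁅ v ⁆ ∷ []))
        (makeEquitable G π₀ π₀) ν

actCell : ∀ {n} → Permutation′ n → Cell n → Cell n
actCell σ X = tabulate (λ w → lookup X (σ ⟨$⟩ˡ w))

actGraph : ∀ {n} → Permutation′ n → Graph n → Graph n
actGraph σ G = record
  { adj    = λ a b → adj G (σ ⟨$⟩ˡ a) (σ ⟨$⟩ˡ b)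
  ; sym    = λ a b → sym G (σ ⟨$⟩ˡ a) (σ ⟨$⟩ˡ b)
  ; irrefl = λ a → irrefl G (σ ⟨$⟩ˡ a)
  }

actColoring : ∀ {n} → Permutation′ n → Coloring n → Coloring n
actColoring σ = map (actCell σ)

actSeq : ∀ {n} → Permutation′ n → List (Fin n) → List (Fin n)
actSeq σ = map (σ ⟨$⟩ʳ_)

-- Both make_equitable and individualization only ever replace a cell, in place, by a list of
-- subsets covering it (Refines). Every such refinement respects the order of colours, keeps
-- each vertex in some cell and keeps the singleton cells, so these properties survive every
-- step of R̄: this gives (1), and (2) because individualizing v creates the cell {v}.
-- For (3), every ingredient of R̄ (cell sizes, neighbour counts, the list operations on α,
-- the choice of the largest class) commutes with relabelling the vertices by σ.

module Submission where

open import Defs hiding (sym)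
open import Data.Nat using (ℕ; zero; suc; _+_; _<_; _≤_; _<ᵇ_; _≡ᵇ_; s≤s; z≤n; s<s⁻¹)
open import Data.Nat.Properties
  using (≡ᵇ⇒≡; ≡⇒≡ᵇ; <⇒<ᵇ; m≤m+n; +-monoʳ-<; <-irrefl; +-0-commutativeMonoid; module ≤-Reasoning)
open import Data.Bool using (Bool; true; false; _∧_; if_then_else_)
import Data.Bool as Bool
open import Data.Bool.Properties using (T-≡; ∧-conicalˡ)
open import Data.Fin using (Fin; _≟_)
open import Data.Fin.Subset
  using (⁅_⁆; ∣_∣; _⊆_; _⊂_; _-_; _─_; _∩_)
  renaming (_∈_ to _∈ₛ_; _∉_ to _∉ₛ_)
open import Data.Fin.Subset.Properties
  using (_∈?_; x∈⁅x⁆; x∈⁅y⁆⇒x≡y; x∈⁅y⁆⇔x≡y; ∣⁅x⁆∣≡1; ⊆-antisym; p⊆q⇒∣p∣≤∣q∣; p⊂q⇒∣p∣<∣q∣;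
         p─q⊆p; x∈p∧x≢y⇒x∈p-y; ∣p∣≤n)
open import Data.Fin.Permutation using (Permutation′; _⟨$⟩ʳ_; _⟨$⟩ˡ_; inverseˡ; inverseʳ; flip)
open import Data.List using (List; []; _∷_; _++_; _∷ʳ_; length; map; filter; foldl; upTo)
open import Data.List.Properties
  using (filter-none; foldl-++; foldl-map; map-cong; map-∘; map-++; length-map)
open import Data.List.Membership.Propositional using (_∈_; find; lose)
open import Data.List.Membership.Propositional.Properties
  using (∈-∃++; ∈-filter⁻; ∈-filter⁺; ∈-map⁻; ∈-map⁺; ∈-upTo⁺)
open import Data.List.Relation.Unary.Any using (Any; here; there; any?)
open import Data.List.Relation.Unary.Any.Properties using (++⁺ˡ; ++⁺ʳ)
open import Data.List.Relation.Unary.All as All using (All; []; _∷_)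
open import Data.List.Relation.Unary.All.Properties using (¬Any⇒All¬)
open import Data.List.Relation.Binary.Permutation.Propositional using (_↭_; prep)
open import Data.List.Relation.Binary.Permutation.Propositional.Properties
  using (∷↭∷ʳ; All-resp-↭; Any-resp-↭)
open import Data.Maybe using (just; nothing)
import Data.Maybe as Maybe
open import Data.Product using (_×_; _,_; proj₁; proj₂)
import Data.Product as Product
open import Data.Vec using ([]; _∷_; tabulate; lookup; zipWith)
open import Data.Vec.Properties
  using (lookup∘tabulate; tabulate∘lookup; tabulate-cong; lookup-zipWith; []=⇒lookup; lookup⇒[]=)
import Algebra.Properties.CommutativeMonoid.Sum +-0-commutativeMonoid as ∑
open import Function using (_∘_; id)
open import Function.Bundles using (Equivalence)
open import Function.Definitions using (Injective)
open import Relation.Nullary using (Dec; yes; no; does; contradiction)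
open import Relation.Nullary.Decidable using (dec-true; dec-false)
open import Relation.Binary.PropositionalEquality

private
  variable
    n : ℕ
    v w : Fin n
    X W C : Cell n
    L π π′ : List (Cell n)

foldl-preserves : ∀ {A B : Set} (P : B → Set) {f : B → A → B} →
  (∀ b x → P b → P (f b x)) → ∀ {b} xs → P b → P (foldl f b xs)
foldl-preserves P pres []       pb = pb
foldl-preserves P pres (x ∷ xs) pb = foldl-preserves P pres xs (pres _ x pb)

foldl-fusion : ∀ {A B C : Set} (h : B → C) {f : B → A → B} {g : C → A → C} →
  (∀ b x → h (f b x) ≡ g (h b) x) → ∀ b xs → h (foldl f b xs) ≡ foldl g (h b) xs
foldl-fusion h         fuse b []       = refl
foldl-fusion h {f} {g} fuse b (x ∷ xs) =
  trans (foldl-fusion h fuse (f b x) xs) (cong (λ c → foldl g c xs) (fuse b x))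

x∈p⇒⁅x⁆⊆p : v ∈ₛ X → ⁅ v ⁆ ⊆ X
x∈p⇒⁅x⁆⊆p {v = v} {X = X} v∈X u∈⁅v⁆ = subst (_∈ₛ X) (sym (x∈⁅y⁆⇒x≡y v u∈⁅v⁆)) v∈X

x∈p∧p⊆⁅x⁆⇒p≡⁅x⁆ : v ∈ₛ X → X ⊆ ⁅ v ⁆ → X ≡ ⁅ v ⁆
x∈p∧p⊆⁅x⁆⇒p≡⁅x⁆ v∈X X⊆⁅v⁆ = ⊆-antisym X⊆⁅v⁆ (x∈p⇒⁅x⁆⊆p v∈X)

x∈p⇒0<∣p∣ : v ∈ₛ X → 0 < ∣ X ∣
x∈p⇒0<∣p∣ {v = v} v∈X = subst (_≤ _) (∣⁅x⁆∣≡1 v) (p⊆q⇒∣p∣≤∣q∣ (x∈p⇒⁅x⁆⊆p v∈X))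

x∈p∧∣p∣≡1⇒p≡⁅x⁆ : v ∈ₛ X → ∣ X ∣ ≡ 1 → X ≡ ⁅ v ⁆
x∈p∧∣p∣≡1⇒p≡⁅x⁆ {v = v} {X = X} v∈X ∣X∣≡1 = x∈p∧p⊆⁅x⁆⇒p≡⁅x⁆ v∈X X⊆⁅v⁆
  where
  X⊆⁅v⁆ : X ⊆ ⁅ v ⁆
  X⊆⁅v⁆ {u} u∈X with u ≟ v
  ... | yes refl = x∈⁅x⁆ v
  ... | no u≢v   =
    contradiction (subst₂ _<_ (∣⁅x⁆∣≡1 v) ∣X∣≡1 (p⊂q⇒∣p∣<∣q∣ ⁅v⁆⊂X)) (<-irrefl refl)
    where
    ⁅v⁆⊂X : ⁅ v ⁆ ⊂ X
    ⁅v⁆⊂X = x∈p⇒⁅x⁆⊆p v∈X , u , u∈X , u≢v ∘ x∈⁅y⁆⇒x≡y v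

isSingletonᵇ⇒≡⁅x⁆ : v ∈ₛ X → isSingletonᵇ X ≡ true → X ≡ ⁅ v ⁆
isSingletonᵇ⇒≡⁅x⁆ {X = X} v∈X single =
  x∈p∧∣p∣≡1⇒p≡⁅x⁆ v∈X (≡ᵇ⇒≡ ∣ X ∣ 1 (Equivalence.from T-≡ single))

∈-tabulate⁻ : ∀ {f : Fin n → Bool} → v ∈ₛ tabulate f → f v ≡ true
∈-tabulate⁻ {v = v} {f} v∈ = trans (sym (lookup∘tabulate f v)) ([]=⇒lookup v∈)

∈-tabulate⁺ : ∀ {f : Fin n → Bool} → f v ≡ true → v ∈ₛ tabulate f
∈-tabulate⁺ {v = v} {f} fv = lookup⇒[]= v (tabulate f) (trans (lookup∘tabulate f v) fv)

record Splits {n} (X : Cell n) (L : List (Cell n)) : Set where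
  field
    parts⊆ : All (_⊆ X) L
    covers : ∀ {v} → v ∈ₛ X → Any (v ∈ₛ_) L
open Splits

Splits-self : Splits X (X ∷ [])
Splits-self = record { parts⊆ = id ∷ [] ; covers = here }

Splits-resp-↭ : L ↭ π → Splits X L → Splits X π
Splits-resp-↭ L↭π S = record
  { parts⊆ = All-resp-↭ L↭π (parts⊆ S)
  ; covers = Any-resp-↭ L↭π ∘ covers S
  }

Splits-∉ : Splits X L → v ∉ₛ X → All (v ∉ₛ_) L
Splits-∉ S v∉X = All.map (λ C⊆X v∈C → v∉X (C⊆X v∈C)) (parts⊆ S)

split-off : v ∈ₛ W → Splits W (⁅ v ⁆ ∷ (W - v) ∷ [])
split-off {v = v} {W = W} v∈W = record
  { parts⊆ = x∈p⇒⁅x⁆⊆p v∈W ∷ p─q⊆p W ⁅ v ⁆ ∷ []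
  ; covers = cover
  }
  where
  cover : ∀ {u} → u ∈ₛ W → Any (u ∈ₛ_) (⁅ v ⁆ ∷ (W - v) ∷ [])
  cover {u} u∈W with u ≟ v
  ... | yes refl = here (x∈⁅x⁆ v)
  ... | no u≢v   = there (here (x∈p∧x≢y⇒x∈p-y u∈W u≢v))

data Refines {n} : Coloring n → Coloring n → Set where
  []  : Refines [] []
  _∷_ : Splits X L → Refines π′ π → Refines (L ++ π′) (X ∷ π)

Refines-refl : ∀ π → Refines {n} π π
Refines-refl []      = []
Refines-refl (X ∷ π) = Splits-self ∷ Refines-refl π

colorOf-++-∉ : All (v ∉ₛ_) L → colorOf (L ++ π) v ≡ length L + colorOf π v
colorOf-++-∉                   []            = refl
colorOf-++-∉ {v = v} {L = C ∷ L} (v∉C ∷ v∉L) with v ∈? C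
... | yes v∈C = contradiction v∈C v∉C
... | no _    = cong suc (colorOf-++-∉ v∉L)

colorOf-++-∈ : Any (v ∈ₛ_) L → colorOf (L ++ π) v < length L
colorOf-++-∈ {v = v} {L = C ∷ L} v∈L with v ∈? C | v∈L
... | yes _   | _          = s≤s z≤n
... | no v∉C  | here v∈C  = contradiction v∈C v∉C
... | no _    | there v∈L′ = s≤s (colorOf-++-∈ v∈L′)

Refines⇒⪯ : Refines π′ π → π′ ⪯ π
Refines⇒⪯ [] u v ()
Refines⇒⪯ (_∷_ {X = X} {L = L} {π′ = π′} S R) u v lt with u ∈? X | v ∈? X
... | yes _   | yes _   = contradiction lt λ ()
... | no _    | yes _   = contradiction lt λ ()
... | yes u∈X | no v∉X  = begin-strict
  colorOf (L ++ π′) u        <⟨ colorOf-++-∈ (covers S u∈X) ⟩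
  length L                   ≤⟨ m≤m+n (length L) (colorOf π′ v) ⟩
  length L + colorOf π′ v    ≡⟨ colorOf-++-∉ (Splits-∉ S v∉X) ⟨
  colorOf (L ++ π′) v        ∎
  where open ≤-Reasoning
... | no u∉X  | no v∉X
  rewrite colorOf-++-∉ {π = π′} (Splits-∉ S u∉X) | colorOf-++-∉ {π = π′} (Splits-∉ S v∉X)
  = +-monoʳ-< (length L) (Refines⇒⪯ R u v (s<s⁻¹ lt))

Refines-covers : Refines π′ π → Any (v ∈ₛ_) π → Any (v ∈ₛ_) π′
Refines-covers (S ∷ _)                 (here v∈X)  = ++⁺ˡ (covers S v∈X)
Refines-covers (_∷_ {L = L} _ R) (there v∈π) = ++⁺ʳ L (Refines-covers R v∈π)

Refines-keeps-singleton : Refines π′ π → ⁅ w ⁆ ∈ π → ⁅ w ⁆ ∈ π′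
Refines-keeps-singleton {w = w} (_∷_ {L = L} S _) (here refl)
  with C , C∈L , w∈C ← find (covers S (x∈⁅x⁆ w))
  = ++⁺ˡ (subst (_∈ L) (x∈p∧p⊆⁅x⁆⇒p≡⁅x⁆ w∈C (All.lookup (parts⊆ S) C∈L)) C∈L)
Refines-keeps-singleton (_∷_ {L = L} _ R) (there w∈π) = ++⁺ʳ L (Refines-keeps-singleton R w∈π)

⪯-refl : π ⪯ π
⪯-refl _ _ = id

Covering : Coloring n → Set
Covering {n} π = ∀ (v : Fin n) → Any (v ∈ₛ_) π

Stable : (Coloring n → Set) → Set
Stable P = ∀ {π′ π} → Refines π′ π → P π → P π′

⪯-stable : ∀ (π₀ : Coloring n) → Stable (_⪯ π₀)
⪯-stable π₀ R π⪯π₀ u v = Refines⇒⪯ R u v ∘ π⪯π₀ u v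

Covering-stable : Stable {n} Covering
Covering-stable R cover v = Refines-covers R (cover v)

singleton-stable : ∀ (w : Fin n) → Stable (⁅ w ⁆ ∈_)
singleton-stable w = Refines-keeps-singleton

nonempty? : (C : Cell n) → Dec ((0 <ᵇ ∣ C ∣) ≡ true)
nonempty? C = (0 <ᵇ ∣ C ∣) Bool.≟ true

degreeClass : Graph n → Cell n → Cell n → ℕ → Cell n
degreeClass G W X c = tabulate (λ v → lookup X v ∧ (degIn G W v ≡ᵇ c))

degreeClass-⊆ : ∀ (G : Graph n) W X c → degreeClass G W X c ⊆ X
degreeClass-⊆ G W X c {v} v∈ =
  lookup⇒[]= v X (∧-conicalˡ (lookup X v) _ (∈-tabulate⁻ v∈))

∈-degreeClass : ∀ (G : Graph n) W → v ∈ₛ X → v ∈ₛ degreeClass G W X (degIn G W v)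
∈-degreeClass {v = v} {X = X} G W v∈X =
  ∈-tabulate⁺ (cong₂ _∧_ ([]=⇒lookup v∈X)
                         (Equivalence.to T-≡ (≡⇒≡ᵇ (degIn G W v) _ refl)))

classes-splits : ∀ (G : Graph n) W X → Splits X (classes G W X)
classes-splits {n} G W X = record
  { parts⊆ = All.tabulate class⊆X
  ; covers = λ {v} v∈X → lose (class∈ v∈X) (∈-degreeClass G W v∈X)
  }
  where
  class⊆X : C ∈ classes G W X → C ⊆ X
  class⊆X C∈ with c , _ , refl ← ∈-map⁻ (degreeClass G W X) (proj₁ (∈-filter⁻ nonempty? C∈))
    = degreeClass-⊆ G W X c

  class∈ : v ∈ₛ X → degreeClass G W X (degIn G W v) ∈ classes G W X
  class∈ {v} v∈X = ∈-filter⁺ nonempty?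
    (∈-map⁺ (degreeClass G W X) (∈-upTo⁺ (s≤s (∣p∣≤n (W ∩ tabulate (adj G v))))))
    (Equivalence.to T-≡ (<⇒<ᵇ (x∈p⇒0<∣p∣ (∈-degreeClass G W v∈X))))

pick-↭ : ∀ j (cs : List (Cell n)) {others Xj} →
  pick j cs ≡ (others , just Xj) → cs ↭ others ∷ʳ Xj
pick-↭ zero    (C ∷ cs) refl = ∷↭∷ʳ C cs
pick-↭ (suc j) (C ∷ cs) eq with pick j cs in eq′
pick-↭ (suc j) (C ∷ cs) refl | _ , just _ = prep C (pick-↭ j cs eq′)

refineCell-splits : ∀ (G : Graph n) W X α → Splits X (proj₁ (refineCell G W X α))
refineCell-splits G W X α
  with isSingletonᵇ X | pick (argmax (classes G W X)) (classes G W X) in eq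
... | true  | _                = Splits-self
... | false | others , nothing = Splits-self
... | false | others , just Xj =
  Splits-resp-↭ (pick-↭ (argmax (classes G W X)) _ eq) (classes-splits G W X)

refineAll-refines : ∀ (G : Graph n) W π α → Refines (proj₁ (refineAll G W π α)) π
refineAll-refines G W []      α = []
refineAll-refines G W (X ∷ π) α =
  refineCell-splits G W X α ∷ refineAll-refines G W π (proj₂ (refineCell G W X α))

meLoop-preserves : ∀ {P : Coloring n → Set} → Stable P →
  ∀ k G π α → P π → P (meLoop k G π α)
meLoop-preserves stable zero    G π α Pπ = Pπ
meLoop-preserves stable (suc k) G π α Pπ with discreteᵇ π | firstIn π α
... | true  | _       = Pπ
... | false | nothing = Pπ
... | false | just W  =
  meLoop-preserves stable k G _ _ (stable (refineAll-refines G W π (removeC W α)) Pπ)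

makeEquitable-preserves : ∀ {P : Coloring n → Set} → Stable P →
  ∀ G π α → P π → P (makeEquitable G π α)
makeEquitable-preserves stable G π α = meLoop-preserves stable (length α + _) G π α

individualize-refines : ∀ (v : Fin n) π → Refines (individualize v π) π
individualize-refines v []      = []
individualize-refines v (W ∷ π) with v ∈? W
... | no _ = Splits-self ∷ individualize-refines v π
... | yes v∈W with isSingletonᵇ W
...   | true  = Refines-refl (W ∷ π)
...   | false = split-off v∈W ∷ Refines-refl π

individualize-isolates : ∀ (v : Fin n) π → Any (v ∈ₛ_) π → ⁅ v ⁆ ∈ individualize v π
individualize-isolates v (W ∷ π) v∈π with v ∈? W | v∈π
... | no v∉W | here v∈W  = contradiction v∈W v∉W
... | no _   | there v∈π′ = there (individualize-isolates v π v∈π′)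
... | yes v∈W | _ with isSingletonᵇ W in single
...   | true  = here (sym (isSingletonᵇ⇒≡⁅x⁆ v∈W single))
...   | false = here refl

refineStep : Graph n → Coloring n → Fin n → Coloring n
refineStep G π v = makeEquitable G (individualize v π) (⁅ v ⁆ ∷ [])

refineStep-preserves : ∀ {P : Coloring n → Set} → Stable P → ∀ G π v → P π → P (refineStep G π v)
refineStep-preserves stable G π v =
  makeEquitable-preserves stable G _ _ ∘ stable (individualize-refines v π)

Rbar-preserves : ∀ {P : Coloring n → Set} → Stable P → ∀ G π₀ ν → P π₀ → P (Rbar G π₀ ν)
Rbar-preserves stable G π₀ ν =
  foldl-preserves _ (refineStep-preserves stable G) ν ∘ makeEquitable-preserves stable G π₀ π₀

refineStep-isolates : ∀ (G : Graph n) {π v} → Any (v ∈ₛ_) π → ⁅ v ⁆ ∈ refineStep G π v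
refineStep-isolates G {π} {v} v∈π =
  makeEquitable-preserves (singleton-stable v) G _ _ (individualize-isolates v π v∈π)

Rbar-isolates : ∀ (G : Graph n) π₀ {ν v} → Covering π₀ → v ∈ ν → ⁅ v ⁆ ∈ Rbar G π₀ ν
Rbar-isolates G π₀ {v = v} covering v∈ν with ν₁ , ν₂ , refl ← ∈-∃++ v∈ν =
  subst (⁅ v ⁆ ∈_) (sym (foldl-++ (refineStep G) _ ν₁ (v ∷ ν₂)))
    (foldl-preserves _ (refineStep-preserves (singleton-stable v) G) ν₂
      (refineStep-isolates G (Rbar-preserves Covering-stable G π₀ ν₁ covering v)))

IsColoring⇒Covering : IsColoring π → Covering π
IsColoring⇒Covering {π = π} (_ , one) v with any? (v ∈?_) π
... | yes v∈π = v∈π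
... | no v∉π  = contradiction
  (trans (cong length (sym (filter-none (v ∈?_) (¬Any⇒All¬ π v∉π)))) (one v)) λ ()

module _ {n} (f : Cell n → Cell n) (f-injective : Injective _≡_ _≡_ f) where

  ≟c-map : ∀ X Y → does (f X ≟c f Y) ≡ does (X ≟c Y)
  ≟c-map X Y with X ≟c Y
  ... | yes refl = dec-true (f X ≟c f X) refl
  ... | no X≢Y   = dec-false (f X ≟c f Y) (X≢Y ∘ f-injective)

  memᵇ-map : ∀ X α → memᵇ (f X) (map f α) ≡ memᵇ X α
  memᵇ-map X []      = refl
  memᵇ-map X (Y ∷ α) rewrite ≟c-map X Y | memᵇ-map X α = refl

  removeC-map : ∀ X α → removeC (f X) (map f α) ≡ map f (removeC X α)
  removeC-map X []      = refl
  removeC-map X (Y ∷ α) rewrite ≟c-map X Y with does (X ≟c Y)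
  ... | true  = removeC-map X α
  ... | false = cong (f Y ∷_) (removeC-map X α)

  replaceC-map : ∀ X Z α → replaceC (f X) (f Z) (map f α) ≡ map f (replaceC X Z α)
  replaceC-map X Z []      = refl
  replaceC-map X Z (Y ∷ α) rewrite ≟c-map X Y with does (X ≟c Y)
  ... | true  = cong (f Z ∷_) (replaceC-map X Z α)
  ... | false = cong (f Y ∷_) (replaceC-map X Z α)

  firstIn-map : ∀ π α → firstIn (map f π) (map f α) ≡ Maybe.map f (firstIn π α)
  firstIn-map []      α = refl
  firstIn-map (X ∷ π) α rewrite memᵇ-map X α with memᵇ X α
  ... | true  = refl
  ... | false = firstIn-map π α

module _ {n} (f : Cell n → Cell n) (∣f∣ : ∀ X → ∣ f X ∣ ≡ ∣ X ∣) where

  isSingletonᵇ-map : ∀ X → isSingletonᵇ (f X) ≡ isSingletonᵇ X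
  isSingletonᵇ-map X = cong (_≡ᵇ 1) (∣f∣ X)

  discreteᵇ-map : ∀ π → discreteᵇ (map f π) ≡ discreteᵇ π
  discreteᵇ-map []      = refl
  discreteᵇ-map (X ∷ π) = cong₂ _∧_ (isSingletonᵇ-map X) (discreteᵇ-map π)

  argmaxFrom-map : ∀ i j size cs → argmaxFrom i j size (map f cs) ≡ argmaxFrom i j size cs
  argmaxFrom-map i j size []       = refl
  argmaxFrom-map i j size (C ∷ cs) rewrite ∣f∣ C with size <ᵇ ∣ C ∣
  ... | true  = argmaxFrom-map _ _ _ cs
  ... | false = argmaxFrom-map _ _ _ cs

  argmax-map : ∀ cs → argmax (map f cs) ≡ argmax cs
  argmax-map []       = refl
  argmax-map (C ∷ cs) rewrite ∣f∣ C = argmaxFrom-map _ _ _ cs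

  filter-nonempty-map : ∀ cs →
    filter nonempty? (map f cs) ≡ map f (filter nonempty? cs)
  filter-nonempty-map []       = refl
  filter-nonempty-map (C ∷ cs) rewrite ∣f∣ C with does (nonempty? C)
  ... | true  = cong (f C ∷_) (filter-nonempty-map cs)
  ... | false = filter-nonempty-map cs

pick-map : ∀ (f : Cell n → Cell n) j cs →
  pick j (map f cs) ≡ Product.map (map f) (Maybe.map f) (pick j cs)
pick-map f j       []       = refl
pick-map f zero    (C ∷ cs) = refl
pick-map f (suc j) (C ∷ cs) rewrite pick-map f j cs = refl

cell-ext : ∀ {X Y : Cell n} → (∀ i → lookup X i ≡ lookup Y i) → X ≡ Y
cell-ext {X = X} {Y} X≗Y =
  trans (sym (tabulate∘lookup X)) (trans (tabulate-cong X≗Y) (tabulate∘lookup Y))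

∣p∣≡∑ : ∀ (X : Cell n) → ∣ X ∣ ≡ ∑.sum (λ i → if lookup X i then 1 else 0)
∣p∣≡∑ []          = refl
∣p∣≡∑ (true ∷ X)  = cong suc (∣p∣≡∑ X)
∣p∣≡∑ (false ∷ X) = ∣p∣≡∑ X

module _ {n} (σ : Permutation′ n) where

  actCell-tabulate : ∀ (g : Fin n → Bool) → actCell σ (tabulate g) ≡ tabulate (g ∘ (σ ⟨$⟩ˡ_))
  actCell-tabulate g = tabulate-cong (lookup∘tabulate g ∘ (σ ⟨$⟩ˡ_))

  lookup-actCell : ∀ X u → lookup (actCell σ X) u ≡ lookup X (σ ⟨$⟩ˡ u)
  lookup-actCell X u = lookup∘tabulate (lookup X ∘ (σ ⟨$⟩ˡ_)) u

  lookup-actCell-ʳ : ∀ X v → lookup (actCell σ X) (σ ⟨$⟩ʳ v) ≡ lookup X v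
  lookup-actCell-ʳ X v = trans (lookup-actCell X _) (cong (lookup X) (inverseˡ σ))

  ∣actCell∣ : ∀ X → ∣ actCell σ X ∣ ≡ ∣ X ∣
  ∣actCell∣ X = begin
    ∣ actCell σ X ∣
      ≡⟨ ∣p∣≡∑ (actCell σ X) ⟩
    ∑.sum (λ i → if lookup (actCell σ X) i then 1 else 0)
      ≡⟨ ∑.sum-cong-≗ (cong (if_then 1 else 0) ∘ lookup-actCell X) ⟩
    ∑.sum (λ i → if lookup X (σ ⟨$⟩ˡ i) then 1 else 0)
      ≡⟨ ∑.sum-permute (λ i → if lookup X i then 1 else 0) (flip σ) ⟨
    ∑.sum (λ i → if lookup X i then 1 else 0)
      ≡⟨ ∣p∣≡∑ X ⟨
    ∣ X ∣ ∎
    where open ≡-Reasoning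

  actCell-injective : Injective _≡_ _≡_ (actCell σ)
  actCell-injective {X} {Y} eq = cell-ext λ v → begin
    lookup X v                        ≡⟨ lookup-actCell-ʳ X v ⟨
    lookup (actCell σ X) (σ ⟨$⟩ʳ v)   ≡⟨ cong (λ Z → lookup Z (σ ⟨$⟩ʳ v)) eq ⟩
    lookup (actCell σ Y) (σ ⟨$⟩ʳ v)   ≡⟨ lookup-actCell-ʳ Y v ⟩
    lookup Y v                        ∎
    where open ≡-Reasoning

  actCell-zipWith : ∀ (_•_ : Bool → Bool → Bool) X Y →
    actCell σ (zipWith _•_ X Y) ≡ zipWith _•_ (actCell σ X) (actCell σ Y)
  actCell-zipWith _•_ X Y = cell-ext λ u → begin
    lookup (actCell σ (zipWith _•_ X Y)) u
      ≡⟨ lookup-actCell (zipWith _•_ X Y) u ⟩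
    lookup (zipWith _•_ X Y) (σ ⟨$⟩ˡ u)
      ≡⟨ lookup-zipWith _•_ _ X Y ⟩
    lookup X (σ ⟨$⟩ˡ u) • lookup Y (σ ⟨$⟩ˡ u)
      ≡⟨ cong₂ _•_ (lookup-actCell X u) (lookup-actCell Y u) ⟨
    lookup (actCell σ X) u • lookup (actCell σ Y) u
      ≡⟨ lookup-zipWith _•_ u (actCell σ X) (actCell σ Y) ⟨
    lookup (zipWith _•_ (actCell σ X) (actCell σ Y)) u ∎
    where open ≡-Reasoning

  ∈-actCell⁺ : v ∈ₛ X → σ ⟨$⟩ʳ v ∈ₛ actCell σ X
  ∈-actCell⁺ {v = v} {X = X} v∈X =
    lookup⇒[]= _ (actCell σ X) (trans (lookup-actCell-ʳ X v) ([]=⇒lookup v∈X))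

  ∈-actCell⁻ : v ∈ₛ actCell σ X → σ ⟨$⟩ˡ v ∈ₛ X
  ∈-actCell⁻ {v = v} {X = X} v∈ =
    lookup⇒[]= _ X (trans (sym (lookup-actCell X v)) ([]=⇒lookup v∈))

  actCell-⁅⁆ : ∀ v → actCell σ ⁅ v ⁆ ≡ ⁅ σ ⟨$⟩ʳ v ⁆
  actCell-⁅⁆ v = ⊆-antisym ⊆⁅σv⁆ (x∈p⇒⁅x⁆⊆p (∈-actCell⁺ (x∈⁅x⁆ v)))
    where
    ⊆⁅σv⁆ : actCell σ ⁅ v ⁆ ⊆ ⁅ σ ⟨$⟩ʳ v ⁆
    ⊆⁅σv⁆ u∈ = Equivalence.from x∈⁅y⁆⇔x≡y
      (trans (sym (inverseʳ σ)) (cong (σ ⟨$⟩ʳ_) (x∈⁅y⁆⇒x≡y v (∈-actCell⁻ u∈))))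

  actCell-─ : ∀ W v → actCell σ (W - v) ≡ actCell σ W - (σ ⟨$⟩ʳ v)
  actCell-─ W v = trans (actCell-zipWith _ W ⁅ v ⁆) (cong (actCell σ W ─_) (actCell-⁅⁆ v))

  degIn-act : ∀ G W w → degIn (actGraph σ G) (actCell σ W) w ≡ degIn G W (σ ⟨$⟩ˡ w)
  degIn-act G W w = begin
    ∣ actCell σ W ∩ tabulate (adj G (σ ⟨$⟩ˡ w) ∘ (σ ⟨$⟩ˡ_)) ∣
      ≡⟨ cong (λ N → ∣ actCell σ W ∩ N ∣) (actCell-tabulate _) ⟨
    ∣ actCell σ W ∩ actCell σ N ∣
      ≡⟨ cong ∣_∣ (actCell-zipWith _∧_ W N) ⟨
    ∣ actCell σ (W ∩ N) ∣
      ≡⟨ ∣actCell∣ (W ∩ N) ⟩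
    ∣ W ∩ N ∣ ∎
    where
    open ≡-Reasoning
    N = tabulate (adj G (σ ⟨$⟩ˡ w))

  degreeClass-act : ∀ G W X c →
    degreeClass (actGraph σ G) (actCell σ W) (actCell σ X) c ≡ actCell σ (degreeClass G W X c)
  degreeClass-act G W X c = trans
    (tabulate-cong λ u → cong₂ (λ b d → b ∧ (d ≡ᵇ c)) (lookup-actCell X u) (degIn-act G W u))
    (sym (actCell-tabulate _))

  classes-act : ∀ G W X →
    classes (actGraph σ G) (actCell σ W) (actCell σ X) ≡ map (actCell σ) (classes G W X)
  classes-act G W X = begin
    filter nonempty? (map (degreeClass G′ (actCell σ W) (actCell σ X)) degrees)
      ≡⟨ cong (filter nonempty?) (map-cong (degreeClass-act G W X) degrees) ⟩
    filter nonempty? (map (actCell σ ∘ degreeClass G W X) degrees)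
      ≡⟨ cong (filter nonempty?) (map-∘ {g = actCell σ} {f = degreeClass G W X} degrees) ⟩
    filter nonempty? (map (actCell σ) (map (degreeClass G W X) degrees))
      ≡⟨ filter-nonempty-map (actCell σ) ∣actCell∣ (map (degreeClass G W X) degrees) ⟩
    map (actCell σ) (classes G W X) ∎
    where
    open ≡-Reasoning
    G′ = actGraph σ G
    degrees = upTo (suc n)

  refineCell-act : ∀ G W X α →
    refineCell (actGraph σ G) (actCell σ W) (actCell σ X) (map (actCell σ) α)
      ≡ Product.map (map (actCell σ)) (map (actCell σ)) (refineCell G W X α)
  refineCell-act G W X α
    rewrite isSingletonᵇ-map (actCell σ) ∣actCell∣ X | classes-act G W X
          | argmax-map (actCell σ) ∣actCell∣ (classes G W X)
          | pick-map (actCell σ) (argmax (classes G W X)) (classes G W X)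
    with isSingletonᵇ X | pick (argmax (classes G W X)) (classes G W X)
  ... | true  | _                = refl
  ... | false | others , nothing = refl
  ... | false | others , just Xj = cong₂ _,_
    (sym (map-++ (actCell σ) others (Xj ∷ [])))
    (trans (cong (_++ map (actCell σ) others) (replaceC-map (actCell σ) actCell-injective X Xj α))
           (sym (map-++ (actCell σ) (replaceC X Xj α) others)))

  refineAll-act : ∀ G W π α →
    refineAll (actGraph σ G) (actCell σ W) (map (actCell σ) π) (map (actCell σ) α)
      ≡ Product.map (map (actCell σ)) (map (actCell σ)) (refineAll G W π α)
  refineAll-act G W []      α = refl
  refineAll-act G W (X ∷ π) α
    rewrite refineCell-act G W X α | refineAll-act G W π (proj₂ (refineCell G W X α))
    = cong (_, map (actCell σ) (proj₂ (refineAll G W π (proj₂ (refineCell G W X α)))))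
        (sym (map-++ (actCell σ) (proj₁ (refineCell G W X α)) _))

  meLoop-act : ∀ k G π α →
    meLoop k (actGraph σ G) (map (actCell σ) π) (map (actCell σ) α)
      ≡ map (actCell σ) (meLoop k G π α)
  meLoop-act zero    G π α = refl
  meLoop-act (suc k) G π α
    rewrite discreteᵇ-map (actCell σ) ∣actCell∣ π | firstIn-map (actCell σ) actCell-injective π α
    with discreteᵇ π | firstIn π α
  ... | true  | _       = refl
  ... | false | nothing = refl
  ... | false | just W
    rewrite removeC-map (actCell σ) actCell-injective W α | refineAll-act G W π (removeC W α)
    = meLoop-act k G _ _

  makeEquitable-act : ∀ G π α →
    makeEquitable (actGraph σ G) (map (actCell σ) π) (map (actCell σ) α)
      ≡ map (actCell σ) (makeEquitable G π α)
  makeEquitable-act G π α rewrite length-map (actCell σ) α = meLoop-act (length α + n) G π α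

  individualize-act : ∀ v π →
    individualize (σ ⟨$⟩ʳ v) (map (actCell σ) π) ≡ map (actCell σ) (individualize v π)
  individualize-act v []      = refl
  individualize-act v (W ∷ π) with v ∈? W | σ ⟨$⟩ʳ v ∈? actCell σ W
  ... | yes v∈W | no σv∉σW = contradiction (∈-actCell⁺ v∈W) σv∉σW
  ... | no v∉W  | yes σv∈σW = contradiction (subst (_∈ₛ W) (inverseˡ σ) (∈-actCell⁻ σv∈σW)) v∉W
  ... | no _    | no _      = cong (actCell σ W ∷_) (individualize-act v π)
  ... | yes _   | yes _ rewrite isSingletonᵇ-map (actCell σ) ∣actCell∣ W with isSingletonᵇ W
  ...   | true  = refl
  ...   | false rewrite actCell-⁅⁆ v | actCell-─ W v = refl

  refineStep-act : ∀ G π v →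
    refineStep (actGraph σ G) (map (actCell σ) π) (σ ⟨$⟩ʳ v) ≡ map (actCell σ) (refineStep G π v)
  refineStep-act G π v = begin
    makeEquitable G′ (individualize (σ ⟨$⟩ʳ v) (map (actCell σ) π)) (⁅ σ ⟨$⟩ʳ v ⁆ ∷ [])
      ≡⟨ cong₂ (λ π′ W → makeEquitable G′ π′ (W ∷ []))
               (individualize-act v π) (sym (actCell-⁅⁆ v)) ⟩
    makeEquitable G′ (map (actCell σ) (individualize v π)) (map (actCell σ) (⁅ v ⁆ ∷ []))
      ≡⟨ makeEquitable-act G (individualize v π) (⁅ v ⁆ ∷ []) ⟩
    map (actCell σ) (refineStep G π v) ∎
    where
    open ≡-Reasoning
    G′ = actGraph σ G

  Rbar-act : ∀ G π₀ ν →
    Rbar (actGraph σ G) (actColoring σ π₀) (actSeq σ ν) ≡ actColoring σ (Rbar G π₀ ν)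
  Rbar-act G π₀ ν = begin
    foldl (refineStep G′) (makeEquitable G′ σπ₀ σπ₀) (map (σ ⟨$⟩ʳ_) ν)
      ≡⟨ foldl-map (refineStep G′) (σ ⟨$⟩ʳ_) _ ν ⟩
    foldl σ-step (makeEquitable G′ σπ₀ σπ₀) ν
      ≡⟨ cong (λ π → foldl σ-step π ν) (makeEquitable-act G π₀ π₀) ⟩
    foldl σ-step (map (actCell σ) (makeEquitable G π₀ π₀)) ν
      ≡⟨ foldl-fusion (map (actCell σ)) (λ π v → sym (refineStep-act G π v)) _ ν ⟨
    map (actCell σ) (Rbar G π₀ ν) ∎
    where
    open ≡-Reasoning
    G′ = actGraph σ G
    σπ₀ = map (actCell σ) π₀
    σ-step : Coloring n → Fin n → Coloring n
    σ-step π v = refineStep G′ π (σ ⟨$⟩ʳ v)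

lemma4p3 : ∀ {n : ℕ} (G : Graph n) (π₀ : Coloring n) (ν : List (Fin n)) →
    IsColoring π₀ →
      (Rbar G π₀ ν ⪯ π₀)
      × (∀ v → v ∈ ν → ⁅ v ⁆ ∈ Rbar G π₀ ν)
      × (∀ (σ : Permutation′ n) →
           Rbar (actGraph σ G) (actColoring σ π₀) (actSeq σ ν)
             ≡ actColoring σ (Rbar G π₀ ν))
lemma4p3 G π₀ ν isColoring =
    Rbar-preserves (⪯-stable π₀) G π₀ ν (⪯-refl {π = π₀})
  , (λ v → Rbar-isolates G π₀ (IsColoring⇒Covering isColoring))
  , (λ σ → Rbar-act σ G π₀ ν)
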